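{- Let $\Delta\geq 2$ be an integer and let $A$ be a generic $\Delta$-modular integer matrix with two rows. Then there exist a positive integer $m\leq\sqrt{\pi/2}\,\sqrt{\Delta}$ and vectors $a,b\in\mathbb{Z}^m$ such that $M(a,b)$ is a generic $\Delta$-submodular matrix of type $m$ with at least as many columns as $A$.
   Context: All matrices are integer matrices with pairwise distinct columns. For $A\in\mathbb{Z}^{2\times n}$ of rank $2$, let $\Delta(A)$ be the maximum absolute value of a $2\times 2$ minor of $A$; $A$ is $\Delta$-modular if $\Delta(A)=\Delta$ and $\Delta$-submodular if $\Delta(A)\leq\Delta$. $A$ is generic if any two of its columns are linearly independent. For a positive integer $m$ and $a,b\in\mathbb{Z}^m$, $M(a,b)$ (a matrix of type $m$) is the $2$-row matrix whose columns are $(0,1)^\intercal$ together with all vectors $(k,j)^\intercal$ with $k\in\{1,\dots,m\}$, $j\in\mathbb{Z}$, $a_k\leq j\leq b_k$ and $\gcd(j,k)=1$ (so there are no columns with first entry $k$ if $a_k>b_k$). -}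

module Defs where

open import Data.Nat as ℕ using (ℕ; zero; suc)
import Data.Nat.GCD as ℕG
open import Data.Integer as ℤ using (ℤ; +_; ∣_∣)
open import Data.Integer.Properties using () renaming (_≤?_ to _≤ℤ?_)
open import Data.Rational as ℚ using (ℚ)
open import Data.Product using (Σ; ∃; _×_; _,_)
open import Data.Fin using (Fin; toℕ)
open import Data.List using (List; []; _∷_; map; filter; upTo; concatMap; allFin; length; lookup)
open import Relation.Nullary using (¬_; yes; no)
open import Relation.Binary.PropositionalEquality using (_≡_; _≢_)

Col : Set
Col = ℤ × ℤ

det : Col → Col → ℤ
det (x₁ , y₁) (x₂ , y₂) = x₁ ℤ.* y₂ ℤ.- x₂ ℤ.* y₁

Rank2 : ∀ {n} → (Fin n → Col) → Set
Rank2 A = ∃ λ i → ∃ λ j → det (A i) (A j) ≢ ℤ.0ℤ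

Generic : ∀ {n} → (Fin n → Col) → Set
Generic A = ∀ i j → i ≢ j → det (A i) (A j) ≢ ℤ.0ℤ

DistinctCols : ∀ {n} → (Fin n → Col) → Set
DistinctCols A = ∀ i j → A i ≡ A j → i ≡ j

IsModular : ℕ → ∀ {n} → (Fin n → Col) → Set
IsModular Δ A = Rank2 A
              × (∀ i j → ∣ det (A i) (A j) ∣ ℕ.≤ Δ)
              × (∃ λ i → ∃ λ j → ∣ det (A i) (A j) ∣ ≡ Δ)

IsSubmodular : ℕ → ∀ {n} → (Fin n → Col) → Set
IsSubmodular Δ A = Rank2 A × (∀ i j → ∣ det (A i) (A j) ∣ ℕ.≤ Δ)

intRange : ℤ → ℤ → List ℤ
intRange a b with a ≤ℤ? b
... | yes _ = map (λ t → a ℤ.+ + t) (upTo (suc ∣ b ℤ.- a ∣))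
... | no _  = []

colsWithFirst : ℕ → ℤ → ℤ → List Col
colsWithFirst k a b =
  map (λ j → (+ k , j)) (filter (λ j → ℕG.gcd ∣ j ∣ k ℕ.≟ 1) (intRange a b))

-- The column list of M(a,b) (matrix of type m); index i : Fin m stands for k = i+1.
Mcols : (m : ℕ) → (Fin m → ℤ) → (Fin m → ℤ) → List Col
Mcols m a b = (+ 0 , + 1) ∷ concatMap (λ i → colsWithFirst (suc (toℕ i)) (a i) (b i)) (allFin m)

Mmat : (m : ℕ) → (a b : Fin m → ℤ) → Fin (length (Mcols m a b)) → Col
Mmat m a b = lookup (Mcols m a b)

-- Euler's series  π/2 = Σ_{k≥0} 2^k (k!)^2 / (2k+1)!  (all terms positive).
-- eulerTerm k = 2^k (k!)^2/(2k+1)!, via eulerTerm (k+1) = eulerTerm k · (k+1)/(2k+3).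
eulerTerm : ℕ → ℚ
eulerTerm zero = ℚ.1ℚ
eulerTerm (suc k) = eulerTerm k ℚ.* ((+ suc k) ℚ./ suc (suc (suc (k ℕ.+ k))))

eulerPartial : ℕ → ℚ
eulerPartial zero = eulerTerm zero
eulerPartial (suc N) = eulerPartial N ℚ.+ eulerTerm (suc N)

-- m ≤ √(π/2)·√Δ  ⇔  m² ≤ (π/2)·Δ  ⇔  ∃ N, m² ≤ Δ · S_N
-- (since S_N ↑ π/2 strictly and π is irrational).
LeSqrtHalfPiDelta : ℕ → ℕ → Set
LeSqrtHalfPiDelta m Δ = ∃ λ N → (+ (m ℕ.* m)) ℚ./ 1 ℚ.≤ ((+ Δ) ℚ./ 1) ℚ.* eulerPartial N

{-# OPTIONS --safe #-}
module Submission where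

-- Unimodular column operations change 2×2 minors only by sign.  Using them, A is brought to a matrix
-- whose first row is bounded by some L with 2L² ≤ 3Δ: a column with largest first entry L is
-- normalised to P = (L , p) with 0 ≤ p ≤ L/2; if all columns satisfy |y| < L, or all satisfy
-- |x − y| < L, that row becomes the new first row; otherwise columns Q with |y| ≥ L and S with
-- |x − y| ≥ L exist, and one of the minors of P, Q, S is at least 2L²/3.
-- Replacing every column by the primitive vector on its line keeps the matrix generic, of rank 2 and
-- Δ-submodular, and keeps the columns distinct.  These primitive columns all lie in M(a,b) when
-- [aₖ, bₖ] is the range of the second entries of those with first entry k.  Every minor of M(a,b)
-- lies between two minors of such extreme columns, and a minor with (0 , 1) is at most m ≤ Δ.
-- Finally m = max(L, 1) satisfies m² ≤ (3/2)Δ ≤ S₃Δ < (π/2)Δ, with S₃ = 32/21 a partial sum of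
-- Euler's series.

open import Defs
open import Data.Nat as ℕ using (ℕ; zero; suc; z≤n; s≤s; NonZero)
import Data.Nat.Properties as ℕ
import Data.Nat.DivMod as ℕ
open import Data.Nat.GCD using (gcd; gcd[m,n]∣m; gcd[m,n]∣n; gcd[m,n]≢0)
open import Data.Nat.Divisibility using (_∣_; divides; ∣-antisym)
open import Data.Nat.Coprimality as Coprime
  using (Coprime; coprime-/gcd; coprime⇒gcd≡1; gcd≡1⇒coprime; coprime-divisor; 1-coprimeTo)
open import Data.Integer as ℤ using (ℤ; +_; -[1+_]; +≤+; -≤+; ∣_∣; _+_; _*_; _-_; -_; _≤_; 0ℤ; sign; _◃_)
open import Data.Integer.Properties
open import Data.Integer.DivMod using (_/ℕ_; _%ℕ_; a≡a%ℕn+[a/ℕn]*n; n%ℕd<d)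
open import Data.Integer.Tactic.RingSolver using (solve-∀)
import Data.Sign as Sign
open import Data.Rational as ℚ using (mkℚ; toℚᵘ)
import Data.Rational.Properties as ℚ
open import Data.Rational.Unnormalised as ℚᵘ using (mkℚᵘ; *≤*)
import Data.Rational.Unnormalised.Properties as ℚᵘ
open import Data.Fin as Fin using (Fin; toℕ)
open import Data.Fin.Properties using (all?; ¬∀⟶∃¬; toℕ-injective; toℕ<n; toℕ-fromℕ<; injective⇒≤)
open import Data.List using (List; []; _∷_; map; filter; upTo; concatMap; allFin; length; lookup; tabulate)
open import Data.List.Extrema ≤-totalOrder
  using (min; max; min≤⊤; min≤xs; ⊥≤max; xs≤max; argmin-sel; argmax-sel)
open import Data.List.Membership.Propositional using (_∈_; lose)
open import Data.List.Membership.Propositional.Properties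
  using ( ∈-map⁺; ∈-map⁻; ∈-filter⁺; ∈-filter⁻; ∈-upTo⁺; ∈-upTo⁻; ∈-concatMap⁺; ∈-concatMap⁻
        ; ∈-allFin; ∈-lookup; ∈-tabulate⁺; ∈-tabulate⁻)
open import Data.List.Relation.Unary.Any as Any using (here; there)
open import Data.List.Relation.Unary.Any.Properties using (lookup-index)
import Data.List.Relation.Unary.All as All
import Data.List.Relation.Unary.All.Properties as All
import Data.List.Relation.Unary.AllPairs as AllPairs
import Data.List.Relation.Unary.AllPairs.Properties as AllPairs
open import Data.List.Relation.Unary.Unique.Propositional using (Unique)
import Data.List.Relation.Unary.Unique.Propositional.Properties as Unique
open import Data.List.Relation.Binary.Disjoint.Propositional using (Disjoint)
open import Data.Product using (Σ; ∃; ∃₂; _×_; _,_; proj₁; proj₂; swap; map₂)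
open import Data.Sum using (_⊎_; inj₁; inj₂; map₁)
open import Data.Unit using (tt)
open import Function using (_∘_)
open import Relation.Binary.PropositionalEquality
open import Relation.Nullary using (Dec; yes; no; contradiction)
open import Relation.Nullary.Decidable using (toWitness)

private
  variable
    A : Set
    n : ℕ
    i j : ℤ

0≤+ : ∀ n → 0ℤ ≤ + n
0≤+ n = +≤+ z≤n

0≤i*j : 0ℤ ≤ i → 0ℤ ≤ j → 0ℤ ≤ i * j
0≤i*j {+ m} {+ n} _ _ = subst (0ℤ ≤_) (pos-* m n) (0≤+ (m ℕ.* n))

0≤c*[j-i] : ∀ {c} → 0ℤ ≤ c → i ≤ j → 0ℤ ≤ c * (j - i)
0≤c*[j-i] 0≤c i≤j = 0≤i*j 0≤c (i≤j⇒0≤j-i i≤j)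

≤-by-difference : ∀ {i j d} → j - i ≡ d → 0ℤ ≤ d → i ≤ j
≤-by-difference j-i≡d 0≤d = 0≤i-j⇒j≤i (subst (0ℤ ≤_) (sym j-i≡d) 0≤d)

i≤+∣i∣ : ∀ i → i ≤ + ∣ i ∣
i≤+∣i∣ (+ n) = ≤-refl
i≤+∣i∣ -[1+ n ] = -≤+

∣i∣≤n⇒i≤n : ∀ {m} → ∣ i ∣ ℕ.≤ m → i ≤ + m
∣i∣≤n⇒i≤n {i} h = ≤-trans (i≤+∣i∣ i) (+≤+ h)

∣i∣≤n⇒-i≤n : ∀ {m} → ∣ i ∣ ℕ.≤ m → - i ≤ + m
∣i∣≤n⇒-i≤n {i} h = ∣i∣≤n⇒i≤n (subst (ℕ._≤ _) (sym (∣-i∣≡∣i∣ i)) h)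

∣i∣≤n⇒-n≤i : ∀ {i d} → ∣ i ∣ ℕ.≤ d → - + d ≤ i
∣i∣≤n⇒-n≤i {i} ∣i∣≤d = subst (_ ≤_) (neg-involutive i) (neg-mono-≤ (∣i∣≤n⇒-i≤n ∣i∣≤d))

-n≤i≤n⇒∣i∣≤n : ∀ {i d} → - + d ≤ i → i ≤ + d → ∣ i ∣ ℕ.≤ d
-n≤i≤n⇒∣i∣≤n { + k } _ i≤d = drop‿+≤+ i≤d
-n≤i≤n⇒∣i∣≤n { -[1+ k ] } {d} -d≤i _ = drop‿+≤+ (subst (+ suc k ≤_) (neg-involutive (+ d)) (neg-mono-≤ -d≤i))

n≤∣i∣⇒n≤i⊎n≤-i : ∀ i {m} → m ℕ.≤ ∣ i ∣ → + m ≤ i ⊎ + m ≤ - i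
n≤∣i∣⇒n≤i⊎n≤-i (+ k) h = inj₁ (+≤+ h)
n≤∣i∣⇒n≤i⊎n≤-i -[1+ k ] h = inj₂ (+≤+ h)

∣i∣≤∣j*i∣ : ∀ {j} i → j ≢ 0ℤ → ∣ i ∣ ℕ.≤ ∣ j * i ∣
∣i∣≤∣j*i∣ {j} i j≢0 = subst (∣ i ∣ ℕ.≤_) (sym (abs-* j i))
  (ℕ.m≤n*m ∣ i ∣ ∣ j ∣ {{ℕ.≢-nonZero (λ ∣j∣≡0 → j≢0 (∣i∣≡0⇒i≡0 ∣j∣≡0))}})

neg : Col → Col
neg (x , y) = (- x , - y)

_≡±_ : Col → Col → Set
u ≡± v = u ≡ v ⊎ u ≡ neg v

det-negˡ : ∀ u v → det (neg u) v ≡ - det u v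
det-negˡ (a , b) (c , d) = identity a b c d
  where
  identity : ∀ a b c d → (- a) * d - c * (- b) ≡ - (a * d - c * b)
  identity = solve-∀

det-negʳ : ∀ u v → det u (neg v) ≡ - det u v
det-negʳ (a , b) (c , d) = identity a b c d
  where
  identity : ∀ a b c d → a * (- d) - (- c) * b ≡ - (a * d - c * b)
  identity = solve-∀

∣det∣-cong-±ˡ : ∀ {u u′} v → u ≡± u′ → ∣ det u v ∣ ≡ ∣ det u′ v ∣
∣det∣-cong-±ˡ v (inj₁ refl) = refl
∣det∣-cong-±ˡ {u′ = u′} v (inj₂ refl) = trans (cong ∣_∣ (det-negˡ u′ v)) (∣-i∣≡∣i∣ (det u′ v))

∣det∣-cong-±ʳ : ∀ u {v v′} → v ≡± v′ → ∣ det u v ∣ ≡ ∣ det u v′ ∣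
∣det∣-cong-±ʳ u (inj₁ refl) = refl
∣det∣-cong-±ʳ u {v′ = v′} (inj₂ refl) = trans (cong ∣_∣ (det-negʳ u v′)) (∣-i∣≡∣i∣ (det u v′))

∣det∣-cong-± : ∀ {u u′ v v′} → u ≡± u′ → v ≡± v′ → ∣ det u v ∣ ≡ ∣ det u′ v′ ∣
∣det∣-cong-± {u′ = u′} {v} u≡±u′ v≡±v′ = trans (∣det∣-cong-±ˡ v u≡±u′) (∣det∣-cong-±ʳ u′ v≡±v′)

det-self : ∀ u → det u u ≡ 0ℤ
det-self (x , y) = identity x y
  where
  identity : ∀ x y → x * y - x * y ≡ + 0
  identity = solve-∀

det-zeroˡ : ∀ v → det (0ℤ , 0ℤ) v ≡ 0ℤ
det-zeroˡ (x , y) = identity x y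
  where
  identity : ∀ x y → + 0 * y - x * + 0 ≡ + 0
  identity = solve-∀

-- Reduction of the first row

Large : ℤ → ℤ → Set
Large L d = + 2 * (L * L) ≤ + 3 * d

-- If 3pq₁ ≤ L² the minor of the first two columns is large; otherwise q₁ > 0, and the sign of s₁
-- decides which of the two minors with the third column is large.
large-minor : ∀ {L p q₁ q₂ s₁ s₂} → 0ℤ ≤ p → + 2 * p ≤ L → q₁ ≤ L → L ≤ q₂ → s₁ + L ≤ s₂ →
  Large L (det (L , p) (q₁ , q₂)) ⊎ Large L (det (L , p) (s₁ , s₂)) ⊎ Large L (det (q₁ , q₂) (s₁ , s₂))
large-minor {L} {p} {q₁} {q₂} {s₁} {s₂} 0≤p 2p≤L q₁≤L L≤q₂ s₁+L≤s₂ =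
  cases (+ 3 * p * q₁ ≤? L * L) (0ℤ ≤? s₁)
  where
  0≤3* : ∀ {x} → 0ℤ ≤ x → 0ℤ ≤ + 3 * x
  0≤3* = 0≤i*j (0≤+ 3)
  p≤L : p ≤ L
  p≤L = ≤-by-difference (identity L p) (+-mono-≤ (i≤j⇒0≤j-i 2p≤L) 0≤p)
    where
    identity : ∀ L p → L - p ≡ (L - + 2 * p) + p
    identity = solve-∀
  0≤L : 0ℤ ≤ L
  0≤L = ≤-trans 0≤p p≤L
  0≤L² : 0ℤ ≤ L * L
  0≤L² = 0≤i*j 0≤L 0≤L
  cases : Dec (+ 3 * p * q₁ ≤ L * L) → Dec (0ℤ ≤ s₁) →
    Large L (det (L , p) (q₁ , q₂)) ⊎ Large L (det (L , p) (s₁ , s₂)) ⊎ Large L (det (q₁ , q₂) (s₁ , s₂))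
  cases (yes 3pq₁≤L²) _ = inj₁ (≤-by-difference (identity L p q₁ q₂)
      (+-mono-≤ (0≤c*[j-i] (0≤3* 0≤L) L≤q₂) (i≤j⇒0≤j-i 3pq₁≤L²)))
    where
    identity : ∀ L p q₁ q₂ →
      + 3 * (L * q₂ - q₁ * p) - + 2 * (L * L) ≡ (+ 3 * L) * (q₂ - L) + (L * L - + 3 * p * q₁)
    identity = solve-∀
  cases (no _) (yes 0≤s₁) = inj₂ (inj₁ (≤-by-difference (identity L p s₁ s₂)
      (+-mono-≤ (+-mono-≤ (0≤c*[j-i] (0≤3* 0≤L) s₁+L≤s₂) (0≤c*[j-i] (0≤3* 0≤s₁) p≤L)) 0≤L²)))
    where
    identity : ∀ L p s₁ s₂ →
      + 3 * (L * s₂ - s₁ * p) - + 2 * (L * L) ≡ (+ 3 * L) * (s₂ - (s₁ + L)) + (+ 3 * s₁) * (L - p) + L * L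
    identity = solve-∀
  cases (no 3pq₁≰L²) (no s₁≱0) = inj₂ (inj₂ (≤-by-difference (identity L p q₁ q₂ s₁ s₂)
      (+-mono-≤ (+-mono-≤ (+-mono-≤ (0≤c*[j-i] (0≤3* 0≤q₁) s₁+L≤s₂) (0≤c*[j-i] (0≤3* 0≤-s₁) L≤q₂))
                          (0≤c*[j-i] (0≤3* 0≤-s₁) q₁≤L))
                (+-mono-≤ (0≤c*[j-i] (0≤3* 0≤q₁) 2p≤L) (0≤c*[j-i] (0≤+ 2) (<⇒≤ L²<3pq₁))))))
    where
    L²<3pq₁ : L * L ℤ.< + 3 * p * q₁
    L²<3pq₁ = ≰⇒> 3pq₁≰L²
    0≤-s₁ : 0ℤ ≤ - s₁
    0≤-s₁ = neg-mono-≤ (<⇒≤ (≰⇒> s₁≱0))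
    0≤q₁ : 0ℤ ≤ q₁
    0≤q₁ with 0ℤ ≤? q₁
    ... | yes 0≤q₁ = 0≤q₁
    ... | no q₁≱0 = contradiction (≤-trans 3pq₁≤0 0≤L²) 3pq₁≰L²
      where
      3pq₁≤0 : + 3 * p * q₁ ≤ 0ℤ
      3pq₁≤0 = subst (+ 3 * p * q₁ ≤_) (*-zeroʳ (+ 3 * p))
        (*-monoˡ-≤-nonNeg (+ 3 * p) {{ℤ.nonNegative (0≤3* 0≤p)}} {q₁} {0ℤ} (<⇒≤ (≰⇒> q₁≱0)))
    identity : ∀ L p q₁ q₂ s₁ s₂ → + 3 * (q₁ * s₂ - s₁ * q₂) - + 2 * (L * L) ≡
      (+ 3 * q₁) * (s₂ - (s₁ + L)) + (+ 3 * (- s₁)) * (q₂ - L) + (+ 3 * (- s₁)) * (L - q₁)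
        + ((+ 3 * q₁) * (L - + 2 * p) + + 2 * (+ 3 * p * q₁ - L * L))
    identity = solve-∀

PreservesAbsDet : (Col → Col) → Set
PreservesAbsDet T = ∀ u v → ∣ det (T u) (T v) ∣ ≡ ∣ det u v ∣

PreservesAbsFirst : (Col → Col) → Set
PreservesAbsFirst T = ∀ u → ∣ proj₁ (T u) ∣ ≡ ∣ proj₁ u ∣

posify : Col → Col
posify (+ k , y) = (+ k , y)
posify (-[1+ k ] , y) = (+ suc k , - y)

posify-≡± : ∀ u → posify u ≡± u
posify-≡± (+ k , y) = inj₁ refl
posify-≡± (-[1+ k ] , y) = inj₂ refl

posify-first : ∀ u → proj₁ (posify u) ≡ + ∣ proj₁ u ∣
posify-first (+ k , y) = refl
posify-first (-[1+ k ] , y) = refl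

shear : ℤ → Col → Col
shear c (x , y) = (x , y - c * x)

reflect : Col → Col
reflect (x , y) = (x , x - y)

skew : Col → Col
skew (x , y) = (x - y , y)

posify-preservesAbsDet : PreservesAbsDet posify
posify-preservesAbsDet u v = ∣det∣-cong-± (posify-≡± u) (posify-≡± v)

shear-preservesAbsDet : ∀ c → PreservesAbsDet (shear c)
shear-preservesAbsDet c (a , b) (d , e) = cong ∣_∣ (identity c a b d e)
  where
  identity : ∀ c a b d e → a * (e - c * d) - d * (b - c * a) ≡ a * e - d * b
  identity = solve-∀

reflect-preservesAbsDet : PreservesAbsDet reflect
reflect-preservesAbsDet (a , b) (d , e) = trans (cong ∣_∣ (identity a b d e)) (∣-i∣≡∣i∣ (a * e - d * b))
  where
  identity : ∀ a b d e → a * (d - e) - d * (a - b) ≡ - (a * e - d * b)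
  identity = solve-∀

swap-preservesAbsDet : PreservesAbsDet swap
swap-preservesAbsDet (a , b) (d , e) = trans (cong ∣_∣ (identity a b d e)) (∣-i∣≡∣i∣ (a * e - d * b))
  where
  identity : ∀ a b d e → b * d - e * a ≡ - (a * e - d * b)
  identity = solve-∀

skew-preservesAbsDet : PreservesAbsDet skew
skew-preservesAbsDet (a , b) (d , e) = cong ∣_∣ (identity a b d e)
  where
  identity : ∀ a b d e → (a - b) * e - (d - e) * b ≡ a * e - d * b
  identity = solve-∀

normalize-column : ∀ l (u : Col) → ∣ proj₁ u ∣ ≡ suc l →
  ∃ λ T → PreservesAbsDet T × PreservesAbsFirst T ×
    ∃ λ p → T u ≡ (+ suc l , p) × 0ℤ ≤ p × + 2 * p ≤ + suc l
normalize-column l u ∣x∣≡L = choose (2 ℕ.* r ℕ.≤? L)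
  where
  L : ℕ
  L = suc l
  y c : ℤ
  y = proj₂ (posify u)
  c = y /ℕ L
  r : ℕ
  r = y %ℕ L
  T₀ : Col → Col
  T₀ = shear c ∘ posify
  T₀-preservesAbsDet : PreservesAbsDet T₀
  T₀-preservesAbsDet v w = trans (shear-preservesAbsDet c (posify v) (posify w)) (posify-preservesAbsDet v w)
  T₀-preservesAbsFirst : PreservesAbsFirst T₀
  T₀-preservesAbsFirst v = cong ∣_∣ (posify-first v)
  T₀u≡[L,r] : T₀ u ≡ (+ L , + r)
  T₀u≡[L,r] = cong₂ _,_ first≡L second≡r
    where
    first≡L : proj₁ (posify u) ≡ + L
    first≡L = trans (posify-first u) (cong +_ ∣x∣≡L)
    cancel : ∀ r c L → (r + c * L) - c * L ≡ r
    cancel = solve-∀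
    open ≡-Reasoning
    second≡r : y - c * proj₁ (posify u) ≡ + r
    second≡r = begin
      y - c * proj₁ (posify u)    ≡⟨ cong (λ x → y - c * x) first≡L ⟩
      y - c * + L                 ≡⟨ cong (_- c * + L) (a≡a%ℕn+[a/ℕn]*n y L) ⟩
      (+ r + c * + L) - c * + L   ≡⟨ cancel (+ r) c (+ L) ⟩
      + r                         ∎
  choose : Dec (2 ℕ.* r ℕ.≤ L) → ∃ λ T → PreservesAbsDet T × PreservesAbsFirst T ×
    ∃ λ p → T u ≡ (+ L , p) × 0ℤ ≤ p × + 2 * p ≤ + L
  choose (yes 2r≤L) = T₀ , T₀-preservesAbsDet , T₀-preservesAbsFirst , + r , T₀u≡[L,r] , 0≤+ r ,
    subst (_≤ + L) (pos-* 2 r) (+≤+ 2r≤L)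
  choose (no 2r≰L) =
    reflect ∘ T₀ , (λ v w → trans (reflect-preservesAbsDet (T₀ v) (T₀ w)) (T₀-preservesAbsDet v w)) ,
    T₀-preservesAbsFirst , + L - + r , cong reflect T₀u≡[L,r] , i≤j⇒0≤j-i (+≤+ (ℕ.<⇒≤ (n%ℕd<d y L))) ,
    ≤-by-difference (identity (+ L) (+ r)) (i≤j⇒0≤j-i (subst (+ L ≤_) (pos-* 2 r) (+≤+ (ℕ.<⇒≤ (ℕ.≰⇒> 2r≰L)))))
    where
    identity : ∀ L r → L - + 2 * (L - r) ≡ + 2 * r - L
    identity = solve-∀

record SameAbsMinors (f g : Fin n → Col) : Set where
  constructor sameAbsMinors
  field
    ∣det∣≡ : ∀ i j → ∣ det (f i) (f j) ∣ ≡ ∣ det (g i) (g j) ∣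

MinorsBounded : ℕ → (Fin n → Col) → Set
MinorsBounded Δ f = ∀ i j → ∣ det (f i) (f j) ∣ ℕ.≤ Δ

FirstRowBounded : ℕ → (Fin n → Col) → Set
FirstRowBounded L f = ∀ i → ∣ proj₁ (f i) ∣ ℕ.≤ L

sameAbsMinors-refl : (f : Fin n → Col) → SameAbsMinors f f
sameAbsMinors-refl f = sameAbsMinors λ i j → refl

sameAbsMinors-trans : {f g h : Fin n → Col} → SameAbsMinors f g → SameAbsMinors g h → SameAbsMinors f h
sameAbsMinors-trans (sameAbsMinors f∼g) (sameAbsMinors g∼h) = sameAbsMinors λ i j → trans (f∼g i j) (g∼h i j)

sameAbsMinors-∘ : ∀ T → PreservesAbsDet T → (g : Fin n → Col) → SameAbsMinors (T ∘ g) g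
sameAbsMinors-∘ T T-det g = sameAbsMinors λ i j → T-det (g i) (g j)

minorsBounded-transfer : ∀ {Δ} {f g : Fin n → Col} → SameAbsMinors f g → MinorsBounded Δ g → MinorsBounded Δ f
minorsBounded-transfer {Δ = Δ} (sameAbsMinors f∼g) g-bounded i j =
  subst (ℕ._≤ Δ) (sym (f∼g i j)) (g-bounded i j)

sameAbsMinors-zeros : {f g : Fin n → Col} → SameAbsMinors f g →
  ∀ i j → det (f i) (f j) ≡ 0ℤ → det (g i) (g j) ≡ 0ℤ
sameAbsMinors-zeros (sameAbsMinors ∣det∣≡) i j det≡0 = ∣i∣≡0⇒i≡0 (trans (sym (∣det∣≡ i j)) (cong ∣_∣ det≡0))

orient-second : ∀ {L} u → ∣ proj₁ u ∣ ℕ.≤ L → L ℕ.≤ ∣ proj₂ u ∣ →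
  ∃ λ v → v ≡± u × proj₁ v ≤ + L × + L ≤ proj₂ v
orient-second (x , y) ∣x∣≤L L≤∣y∣ with n≤∣i∣⇒n≤i⊎n≤-i y L≤∣y∣
... | inj₁ L≤y = (x , y) , inj₁ refl , ∣i∣≤n⇒i≤n ∣x∣≤L , L≤y
... | inj₂ L≤-y = neg (x , y) , inj₂ refl , ∣i∣≤n⇒-i≤n ∣x∣≤L , L≤-y

orient-difference : ∀ {L} u → L ℕ.≤ ∣ proj₁ u - proj₂ u ∣ →
  ∃ λ v → v ≡± u × proj₁ v + + L ≤ proj₂ v
orient-difference {L} (x , y) L≤∣x-y∣ with n≤∣i∣⇒n≤i⊎n≤-i (x - y) L≤∣x-y∣
... | inj₁ L≤x-y = neg (x , y) , inj₂ refl , ≤-by-difference (identity x y (+ L)) (i≤j⇒0≤j-i L≤x-y)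
  where
  identity : ∀ x y L → (- y) - ((- x) + L) ≡ (x - y) - L
  identity = solve-∀
... | inj₂ L≤y-x = (x , y) , inj₁ refl , ≤-by-difference (identity x y (+ L)) (i≤j⇒0≤j-i L≤y-x)
  where
  identity : ∀ x y L → y - (x + L) ≡ (- (x - y)) - L
  identity = solve-∀

module _ {Δ : ℕ} (g : Fin n → Col) (g-bounded : MinorsBounded Δ g) where

  Signed : Col → Set
  Signed u = ∃ λ i → u ≡± g i

  large⇒bound : ∀ {L u v} → Signed u → Signed v → Large (+ L) (det u v) → 2 ℕ.* (L ℕ.* L) ℕ.≤ 3 ℕ.* Δ
  large⇒bound {L} {u} {v} (i , u≡±) (j , v≡±) large = drop‿+≤+ (begin
    + (2 ℕ.* (L ℕ.* L))   ≡⟨ pos-* 2 (L ℕ.* L) ⟩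
    + 2 * + (L ℕ.* L)     ≡⟨ cong (+ 2 *_) (pos-* L L) ⟩
    + 2 * (+ L * + L)     ≤⟨ large ⟩
    + 3 * det u v         ≤⟨ *-monoˡ-≤-nonNeg (+ 3) (≤-trans (i≤+∣i∣ (det u v)) (+≤+ ∣det∣≤Δ)) ⟩
    + 3 * + Δ             ≡⟨ pos-* 3 Δ ⟨
    + (3 ℕ.* Δ)           ∎)
    where
    open ≤-Reasoning
    ∣det∣≤Δ : ∣ det u v ∣ ℕ.≤ Δ
    ∣det∣≤Δ = subst (ℕ._≤ Δ) (sym (∣det∣-cong-± u≡± v≡±)) (g-bounded i j)

  wide-columns⇒bound : ∀ {L p} i₀ iq is → g i₀ ≡ (+ L , p) → 0ℤ ≤ p → + 2 * p ≤ + L → FirstRowBounded L g →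
    L ℕ.≤ ∣ proj₂ (g iq) ∣ → L ℕ.≤ ∣ proj₁ (g is) - proj₂ (g is) ∣ → 2 ℕ.* (L ℕ.* L) ℕ.≤ 3 ℕ.* Δ
  wide-columns⇒bound {L} {p} i₀ iq is g-i₀ 0≤p 2p≤L bounded wide-q wide-s
    with orient-second (g iq) (bounded iq) wide-q | orient-difference (g is) wide-s
  ... | (q₁ , q₂) , Q≡± , q₁≤L , L≤q₂ | (s₁ , s₂) , S≡± , s₁+L≤s₂
    with large-minor {+ L} {p} {q₁} {q₂} {s₁} {s₂} 0≤p 2p≤L q₁≤L L≤q₂ s₁+L≤s₂
  ... | inj₁ large = large⇒bound {L} (i₀ , inj₁ (sym g-i₀)) (iq , Q≡±) large
  ... | inj₂ (inj₁ large) = large⇒bound {L} (i₀ , inj₁ (sym g-i₀)) (is , S≡±) large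
  ... | inj₂ (inj₂ large) = large⇒bound {L} (iq , Q≡±) (is , S≡±) large

bounded-or-exceeds : ∀ l (h : Fin n → ℕ) → (∀ i → h i ℕ.≤ l) ⊎ ∃ λ i → suc l ℕ.≤ h i
bounded-or-exceeds {n} l h with all? (λ i → h i ℕ.≤? l)
... | yes bounded = inj₁ bounded
... | no ¬bounded = inj₂ (map₂ ℕ.≰⇒> (¬∀⟶∃¬ n _ (λ i → h i ℕ.≤? l) ¬bounded))

module _ {Δ : ℕ} where

  ShrinksTo : ℕ → (Fin n → Col) → Set
  ShrinksTo l g = ∃ λ g′ → SameAbsMinors g′ g × FirstRowBounded l g′

  shrink-first-row-normalised : ∀ l (g : Fin n → Col) → MinorsBounded Δ g → FirstRowBounded (suc l) g →
    ∀ i₀ {p} → g i₀ ≡ (+ suc l , p) → 0ℤ ≤ p → + 2 * p ≤ + suc l →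
    ShrinksTo l g ⊎ 2 ℕ.* (suc l ℕ.* suc l) ℕ.≤ 3 ℕ.* Δ
  shrink-first-row-normalised l g g-bounded bounded i₀ g-i₀ 0≤p 2p≤L
    with bounded-or-exceeds l (∣_∣ ∘ proj₂ ∘ g) | bounded-or-exceeds l (λ i → ∣ proj₁ (g i) - proj₂ (g i) ∣)
  ... | inj₁ seconds-bounded | _ =
    inj₁ (swap ∘ g , sameAbsMinors-∘ swap swap-preservesAbsDet g , seconds-bounded)
  ... | inj₂ _ | inj₁ differences-bounded =
    inj₁ (skew ∘ g , sameAbsMinors-∘ skew skew-preservesAbsDet g , differences-bounded)
  ... | inj₂ (iq , wide-q) | inj₂ (is , wide-s) =
    inj₂ (wide-columns⇒bound g g-bounded i₀ iq is g-i₀ 0≤p 2p≤L bounded wide-q wide-s)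

  shrink-first-row : ∀ l (g : Fin n → Col) → MinorsBounded Δ g → FirstRowBounded (suc l) g →
    ShrinksTo l g ⊎ 2 ℕ.* (suc l ℕ.* suc l) ℕ.≤ 3 ℕ.* Δ
  shrink-first-row l g g-bounded bounded with bounded-or-exceeds l (∣_∣ ∘ proj₁ ∘ g)
  ... | inj₁ small = inj₁ (g , sameAbsMinors-refl g , small)
  ... | inj₂ (i₀ , wide) with normalize-column l (g i₀) (ℕ.≤-antisym (bounded i₀) wide)
  ... | T , T-det , T-first , p , Tg-i₀ , 0≤p , 2p≤L =
    map₁ (λ (g′ , g′∼Tg , g′-small) → g′ , sameAbsMinors-trans g′∼Tg T∘g∼g , g′-small)
      (shrink-first-row-normalised l (T ∘ g) (minorsBounded-transfer T∘g∼g g-bounded)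
        (λ i → subst (ℕ._≤ suc l) (sym (T-first (g i))) (bounded i)) i₀ Tg-i₀ 0≤p 2p≤L)
    where
    T∘g∼g : SameAbsMinors (T ∘ g) g
    T∘g∼g = sameAbsMinors-∘ T T-det g

  reduce-first-row-from : ∀ L (f : Fin n → Col) → MinorsBounded Δ f → FirstRowBounded L f →
    ∃₂ λ g L′ → SameAbsMinors g f × FirstRowBounded L′ g × 2 ℕ.* (L′ ℕ.* L′) ℕ.≤ 3 ℕ.* Δ
  reduce-first-row-from zero f _ bounded = f , 0 , sameAbsMinors-refl f , bounded , z≤n
  reduce-first-row-from (suc l) f f-bounded bounded with shrink-first-row l f f-bounded bounded
  ... | inj₂ large = f , suc l , sameAbsMinors-refl f , bounded , large
  ... | inj₁ (g , g∼f , g-small) with reduce-first-row-from l g (minorsBounded-transfer g∼f f-bounded) g-small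
  ... | h , L′ , h∼g , rest = h , L′ , sameAbsMinors-trans h∼g g∼f , rest

firstRow-bound : (f : Fin n → Col) → ∃ λ L → FirstRowBounded L f
firstRow-bound {zero} f = 0 , λ ()
firstRow-bound {suc n} f with firstRow-bound (f ∘ Fin.suc)
... | L , bounded = ∣ proj₁ (f Fin.zero) ∣ ℕ.⊔ L , λ
  { Fin.zero → ℕ.m≤m⊔n _ L
  ; (Fin.suc i) → ℕ.≤-trans (bounded i) (ℕ.m≤n⊔m _ L) }

reduce-first-row : ∀ {Δ} (f : Fin n → Col) → MinorsBounded Δ f →
  ∃₂ λ g L → SameAbsMinors g f × FirstRowBounded L g × 2 ℕ.* (L ℕ.* L) ℕ.≤ 3 ℕ.* Δ
reduce-first-row f f-bounded =
  reduce-first-row-from (proj₁ (firstRow-bound f)) f f-bounded (proj₂ (firstRow-bound f))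

-- Primitive columns

-- Primitive vectors normalised up to sign: (0 , 1), or first entry positive and coprime to the
-- second.  These are exactly the shapes of the columns of M(a,b).
data Primitive : Col → Set where
  vertical : Primitive (+ 0 , + 1)
  slanted : ∀ k {j} → gcd ∣ j ∣ (suc k) ≡ 1 → Primitive (+ suc k , j)

coprime-cross⇒∣ : ∀ {k k′} q q′ → gcd q k ≡ 1 → k ℕ.* q′ ≡ k′ ℕ.* q → k ∣ k′
coprime-cross⇒∣ {k} {k′} q q′ c cross = coprime-divisor (Coprime.sym (gcd≡1⇒coprime {q} {k} c))
  (divides q′ (trans (ℕ.*-comm q k′) (trans (sym cross) (ℕ.*-comm k q′))))

coprime-parallel⇒≡ : ∀ {k k′ j j′} → gcd ∣ j ∣ (suc k) ≡ 1 → gcd ∣ j′ ∣ (suc k′) ≡ 1 →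
  + suc k * j′ ≡ + suc k′ * j → suc k ≡ suc k′ × j ≡ j′
coprime-parallel⇒≡ {k} {k′} {j} {j′} c c′ cross = k≡k′ , j≡j′
  where
  ∣cross∣ : suc k ℕ.* ∣ j′ ∣ ≡ suc k′ ℕ.* ∣ j ∣
  ∣cross∣ = trans (sym (abs-* (+ suc k) j′)) (trans (cong ∣_∣ cross) (abs-* (+ suc k′) j))
  k≡k′ : suc k ≡ suc k′
  k≡k′ = ∣-antisym (coprime-cross⇒∣ ∣ j ∣ ∣ j′ ∣ c ∣cross∣) (coprime-cross⇒∣ ∣ j′ ∣ ∣ j ∣ c′ (sym ∣cross∣))
  j≡j′ : j ≡ j′
  j≡j′ = sym (*-cancelˡ-≡ (+ suc k) j′ j (trans cross (cong (λ x → + x * j) (sym k≡k′))))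

primitive-det≡0⇒≡ : ∀ {u v} → Primitive u → Primitive v → det u v ≡ 0ℤ → u ≡ v
primitive-det≡0⇒≡ vertical vertical _ = refl
primitive-det≡0⇒≡ vertical (slanted k _) ()
primitive-det≡0⇒≡ (slanted k _) vertical ()
primitive-det≡0⇒≡ (slanted k {j} c) (slanted k′ {j′} c′) det≡0
  with coprime-parallel⇒≡ c c′ (i-j≡0⇒i≡j (+ suc k * j′) (+ suc k′ * j) det≡0)
... | refl , refl = refl

infixr 7 _·_
_·_ : ℤ → Col → Col
c · (x , y) = (c * x , c * y)

det-· : ∀ c d u v → det (c · u) (d · v) ≡ (c * d) * det u v
det-· c d (x , y) (x′ , y′) = identity c d x y x′ y′
  where
  identity : ∀ c d x y x′ y′ → (c * x) * (d * y′) - (d * x′) * (c * y) ≡ (c * d) * (x * y′ - x′ * y)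
  identity = solve-∀

neg-· : ∀ c v → neg (c · v) ≡ (- c) · v
neg-· c (x , y) = cong₂ _,_ (neg-distribˡ-* c x) (neg-distribˡ-* c y)

∣first∣≤∣first-scaled∣ : ∀ {c} → c ≢ 0ℤ → ∀ u → ∣ proj₁ u ∣ ℕ.≤ ∣ proj₁ (c · u) ∣
∣first∣≤∣first-scaled∣ c≢0 (x , _) = ∣i∣≤∣j*i∣ x c≢0

∣det∣≤∣det-scaled∣ : ∀ {c d} → c ≢ 0ℤ → d ≢ 0ℤ → ∀ u v → ∣ det u v ∣ ℕ.≤ ∣ det (c · u) (d · v) ∣
∣det∣≤∣det-scaled∣ {c} {d} c≢0 d≢0 u v =
  subst (∣ det u v ∣ ℕ.≤_) (cong ∣_∣ (sym (det-· c d u v))) (∣i∣≤∣j*i∣ (det u v) cd≢0)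
  where
  cd≢0 : c * d ≢ 0ℤ
  cd≢0 cd≡0 with i*j≡0⇒i≡0∨j≡0 c cd≡0
  ... | inj₁ c≡0 = c≢0 c≡0
  ... | inj₂ d≡0 = d≢0 d≡0

det-scaled≡0 : ∀ c d {u v} → det u v ≡ 0ℤ → det (c · u) (d · v) ≡ 0ℤ
det-scaled≡0 c d {u} {v} det≡0 = trans (det-· c d u v) (trans (cong (c * d *_) det≡0) (*-zeroʳ (c * d)))

divide-by-gcd : ∀ m n .{{_ : NonZero m}} → ∃ λ d → ∃ λ k → ∃ λ q → m ≡ d ℕ.* k × n ≡ d ℕ.* q × Coprime k q
divide-by-gcd m n = gcd m n , m ℕ./ gcd m n , n ℕ./ gcd m n ,
  sym (ℕ.m*[n/m]≡n (gcd[m,n]∣m m n)) , sym (ℕ.m*[n/m]≡n (gcd[m,n]∣n m n)) , coprime-/gcd m n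
  where
  instance
    gcd≢0 : NonZero (gcd m n)
    gcd≢0 = ℕ.≢-nonZero (gcd[m,n]≢0 m n (inj₁ (ℕ.≢-nonZero⁻¹ m)))

positive-decomposition : ∀ a y → ∃₂ λ c v → c ≢ 0ℤ × Primitive v × (+ suc a , y) ≡ c · v
positive-decomposition a y with divide-by-gcd (suc a) ∣ y ∣
... | d , zero , q , a≡d*0 , _ , _ = contradiction (trans a≡d*0 (ℕ.*-zeroʳ d)) λ ()
... | d , suc k , q , a≡dk , ∣y∣≡dq , coprime =
  + d , (+ suc k , sign y ◃ q) , d≢0 , slanted k gcd≡1 , cong₂ _,_ x≡dk y≡dj
  where
  open ≡-Reasoning
  d≢0 : + d ≢ 0ℤ
  d≢0 refl = contradiction a≡dk λ ()
  gcd≡1 : gcd ∣ sign y ◃ q ∣ (suc k) ≡ 1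
  gcd≡1 = trans (cong (λ x → gcd x (suc k)) (abs-◃ (sign y) q)) (coprime⇒gcd≡1 (Coprime.sym coprime))
  x≡dk : + suc a ≡ + d * + suc k
  x≡dk = trans (cong +_ a≡dk) (pos-* d (suc k))
  y≡dj : y ≡ + d * (sign y ◃ q)
  y≡dj = begin
    y                         ≡⟨ signᵢ◃∣i∣≡i y ⟨
    sign y ◃ ∣ y ∣            ≡⟨ cong (sign y ◃_) ∣y∣≡dq ⟩
    sign y ◃ (d ℕ.* q)        ≡⟨ ◃-distrib-* Sign.+ (sign y) d q ⟩
    (Sign.+ ◃ d) * (sign y ◃ q) ≡⟨ cong (_* (sign y ◃ q)) (+◃n≡+n d) ⟩
    + d * (sign y ◃ q)        ∎

primitive-decomposition : ∀ u → u ≢ (0ℤ , 0ℤ) → ∃₂ λ c v → c ≢ 0ℤ × Primitive v × u ≡ c · v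
primitive-decomposition (+ zero , y) u≢0 = y , (+ 0 , + 1) , (λ y≡0 → u≢0 (cong (0ℤ ,_) y≡0)) , vertical ,
  cong₂ _,_ (sym (*-zeroʳ y)) (sym (*-identityʳ y))
primitive-decomposition (+ suc a , y) _ = positive-decomposition a y
primitive-decomposition (-[1+ a ] , y) _ with positive-decomposition a (- y)
... | c , v , c≢0 , v-primitive , u≡cv = - c , v , (λ -c≡0 → c≢0 (neg-injective -c≡0)) , v-primitive ,
  trans (cong₂ _,_ refl (sym (neg-involutive y))) (trans (cong neg u≡cv) (neg-· c v))

generic⇒injective : {f : Fin n → Col} → Generic f → ∀ {i j} → f i ≡ f j → i ≡ j
generic⇒injective {f = f} generic {i} {j} fi≡fj with i Fin.≟ j
... | yes i≡j = i≡j
... | no i≢j = contradiction (trans (cong (det (f i)) (sym fi≡fj)) (det-self (f i))) (generic i j i≢j)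

generic-rank2⇒nonzero : {f : Fin n → Col} → Generic f → Rank2 f → ∀ i → f i ≢ (0ℤ , 0ℤ)
generic-rank2⇒nonzero {f = f} generic (i₀ , j₀ , det≢0) i fi≡0 with i Fin.≟ i₀
... | yes refl = det≢0 (trans (cong (λ u → det u (f j₀)) fi≡0) (det-zeroˡ (f j₀)))
... | no i≢i₀ = generic i i₀ i≢i₀ (trans (cong (λ u → det u (f i₀)) fi≡0) (det-zeroˡ (f i₀)))

module _ (f g : Fin n → Col) (zeros-reflect : ∀ i j → det (f i) (f j) ≡ 0ℤ → det (g i) (g j) ≡ 0ℤ) where

  generic-reflect : Generic g → Generic f
  generic-reflect generic i j i≢j det≡0 = generic i j i≢j (zeros-reflect i j det≡0)

  rank2-reflect : Rank2 g → Rank2 f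
  rank2-reflect (i , j , det≢0) = i , j , λ det≡0 → det≢0 (zeros-reflect i j det≡0)

to-primitive-columns : ∀ {Δ L} (g : Fin n → Col) →
  Rank2 g → Generic g → MinorsBounded Δ g → FirstRowBounded L g →
  ∃ λ P → (∀ i → Primitive (P i)) × FirstRowBounded L P × Rank2 P × Generic P × MinorsBounded Δ P
to-primitive-columns {n} g rank generic bounded rows =
  P , P-primitive , (λ i → ℕ.≤-trans (∣first∣≤ i) (rows i)) , rank2-reflect P g zeros rank ,
  generic-reflect P g zeros generic , λ i j → ℕ.≤-trans (∣det∣≤ i j) (bounded i j)
  where
  decomposition : ∀ i → ∃₂ λ c v → c ≢ 0ℤ × Primitive v × g i ≡ c · v
  decomposition i = primitive-decomposition (g i) (generic-rank2⇒nonzero {f = g} generic rank i)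
  c : Fin n → ℤ
  c i = proj₁ (decomposition i)
  P : Fin n → Col
  P i = proj₁ (proj₂ (decomposition i))
  c≢0 : ∀ i → c i ≢ 0ℤ
  c≢0 i = proj₁ (proj₂ (proj₂ (decomposition i)))
  P-primitive : ∀ i → Primitive (P i)
  P-primitive i = proj₁ (proj₂ (proj₂ (proj₂ (decomposition i))))
  g≡cP : ∀ i → g i ≡ c i · P i
  g≡cP i = proj₂ (proj₂ (proj₂ (proj₂ (decomposition i))))
  ∣first∣≤ : ∀ i → ∣ proj₁ (P i) ∣ ℕ.≤ ∣ proj₁ (g i) ∣
  ∣first∣≤ i = subst (λ u → ∣ proj₁ (P i) ∣ ℕ.≤ ∣ proj₁ u ∣) (sym (g≡cP i))
    (∣first∣≤∣first-scaled∣ (c≢0 i) (P i))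
  ∣det∣≤ : ∀ i j → ∣ det (P i) (P j) ∣ ℕ.≤ ∣ det (g i) (g j) ∣
  ∣det∣≤ i j = subst₂ (λ u v → ∣ det (P i) (P j) ∣ ℕ.≤ ∣ det u v ∣) (sym (g≡cP i)) (sym (g≡cP j))
    (∣det∣≤∣det-scaled∣ (c≢0 i) (c≢0 j) (P i) (P j))
  zeros : ∀ i j → det (P i) (P j) ≡ 0ℤ → det (g i) (g j) ≡ 0ℤ
  zeros i j det≡0 = subst₂ (λ u v → det u v ≡ 0ℤ) (sym (g≡cP i)) (sym (g≡cP j)) (det-scaled≡0 (c i) (c j) det≡0)

primitive-reduction : ∀ {Δ} (A : Fin n → Col) → Rank2 A → Generic A → MinorsBounded Δ A →
  ∃₂ λ P L → (∀ i → Primitive (P i)) × FirstRowBounded L P × Rank2 P × Generic P × MinorsBounded Δ P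
    × 2 ℕ.* (L ℕ.* L) ℕ.≤ 3 ℕ.* Δ
primitive-reduction A rank generic bounded =
  let g , L , g∼A , g-rows , 2L²≤3Δ = reduce-first-row A bounded
      zeros = sameAbsMinors-zeros g∼A
      P , P-primitive , P-rows , P-rank , P-generic , P-bounded =
        to-primitive-columns g (rank2-reflect g A zeros rank) (generic-reflect g A zeros generic)
          (minorsBounded-transfer g∼A bounded) g-rows
  in P , L , P-primitive , P-rows , P-rank , P-generic , P-bounded , 2L²≤3Δ

-- Matrices of type m

∈-intRange⁻ : ∀ {a b j} → j ∈ intRange a b → a ≤ j × j ≤ b
∈-intRange⁻ {a = a} {b} j∈ with a ≤? b
... | yes a≤b with ∈-map⁻ (λ t → a + + t) j∈
... | t , t∈ , refl = i≤i+j a (+ t) , ≤-by-difference (identity a b (+ t)) (subst (0ℤ ≤_) b-a-t≡ 0≤∣b-a∣-t)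
  where
  identity : ∀ a b t → b - (a + t) ≡ (b - a) - t
  identity = solve-∀
  0≤∣b-a∣-t : 0ℤ ≤ + ∣ b - a ∣ - + t
  0≤∣b-a∣-t = i≤j⇒0≤j-i (+≤+ (ℕ.≤-pred (∈-upTo⁻ t∈)))
  b-a-t≡ : + ∣ b - a ∣ - + t ≡ (b - a) - + t
  b-a-t≡ = cong (_- + t) (0≤i⇒+∣i∣≡i (i≤j⇒0≤j-i a≤b))

∈-intRange⁺ : ∀ {a b j} → a ≤ j → j ≤ b → j ∈ intRange a b
∈-intRange⁺ {a} {b} {j} a≤j j≤b with a ≤? b
... | no a≰b = contradiction (≤-trans a≤j j≤b) a≰b
... | yes a≤b = subst (_∈ intRange′) a+[j-a]≡j (∈-map⁺ (λ t → a + + t) (∈-upTo⁺ (s≤s (drop‿+≤+ j-a≤b-a))))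
  where
  intRange′ : List ℤ
  intRange′ = map (λ t → a + + t) (upTo (suc ∣ b - a ∣))
  +∣j-a∣≡j-a : + ∣ j - a ∣ ≡ j - a
  +∣j-a∣≡j-a = 0≤i⇒+∣i∣≡i (i≤j⇒0≤j-i a≤j)
  a+[j-a]≡j : a + + ∣ j - a ∣ ≡ j
  a+[j-a]≡j = trans (cong (λ i → a + i) +∣j-a∣≡j-a) (identity a j)
    where
    identity : ∀ a j → a + (j - a) ≡ j
    identity = solve-∀
  j-a≤b-a : + ∣ j - a ∣ ≤ + ∣ b - a ∣
  j-a≤b-a = subst₂ _≤_ (sym +∣j-a∣≡j-a) (sym (0≤i⇒+∣i∣≡i (i≤j⇒0≤j-i a≤b))) (+-monoˡ-≤ (- a) j≤b)

intRange-unique : ∀ a b → Unique (intRange a b)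
intRange-unique a b with a ≤? b
... | no _ = AllPairs.[]
... | yes _ = Unique.map⁺ (λ a+s≡a+t → +-injective (+-cancelˡ a a+s≡a+t)) (Unique.upTo⁺ _)
  where
  +-cancelˡ : ∀ a {i j} → a + i ≡ a + j → i ≡ j
  +-cancelˡ a {i} {j} eq = trans (sym (identity a i)) (trans (cong (_- a) eq) (identity a j))
    where
    identity : ∀ a i → (a + i) - a ≡ i
    identity = solve-∀

∈-colsWithFirst⁻ : ∀ {k a b x} → x ∈ colsWithFirst k a b →
  ∃ λ j → x ≡ (+ k , j) × a ≤ j × j ≤ b × gcd ∣ j ∣ k ≡ 1
∈-colsWithFirst⁻ {k} {a} {b} x∈ with ∈-map⁻ (λ j → (+ k , j)) x∈
... | j , j∈ , refl with ∈-filter⁻ (λ j → gcd ∣ j ∣ k ℕ.≟ 1) j∈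
... | j∈range , coprime = j , refl , proj₁ a≤j≤b , proj₂ a≤j≤b , coprime
  where
  a≤j≤b : a ≤ j × j ≤ b
  a≤j≤b = ∈-intRange⁻ {a = a} {b} j∈range

∈-colsWithFirst⁺ : ∀ {k a b j} → a ≤ j → j ≤ b → gcd ∣ j ∣ k ≡ 1 → (+ k , j) ∈ colsWithFirst k a b
∈-colsWithFirst⁺ {k} a≤j j≤b coprime =
  ∈-map⁺ (λ j → (+ k , j)) (∈-filter⁺ (λ j → gcd ∣ j ∣ k ℕ.≟ 1) (∈-intRange⁺ a≤j j≤b) coprime)

colsWithFirst-unique : ∀ k a b → Unique (colsWithFirst k a b)
colsWithFirst-unique k a b =
  Unique.map⁺ (cong proj₂) (Unique.filter⁺ (λ j → gcd ∣ j ∣ k ℕ.≟ 1) (intRange-unique a b))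

module _ {m : ℕ} (a b : Fin m → ℤ) where

  data MColumn : Col → Set where
    vertical : MColumn (+ 0 , + 1)
    slanted : ∀ t {j} → a t ≤ j → j ≤ b t → gcd ∣ j ∣ (suc (toℕ t)) ≡ 1 → MColumn (+ suc (toℕ t) , j)

  private
    column-block : Fin m → List Col
    column-block t = colsWithFirst (suc (toℕ t)) (a t) (b t)

    ∈-column-block⁻ : ∀ {t x} → x ∈ column-block t →
      ∃ λ j → x ≡ (+ suc (toℕ t) , j) × a t ≤ j × j ≤ b t × gcd ∣ j ∣ (suc (toℕ t)) ≡ 1
    ∈-column-block⁻ {t} = ∈-colsWithFirst⁻ {suc (toℕ t)} {a t} {b t}

    ∈-blocks⁻ : ∀ {x} → x ∈ concatMap column-block (allFin m) → ∃ λ t → x ∈ column-block t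
    ∈-blocks⁻ x∈ = Any.satisfied (∈-concatMap⁻ column-block {xs = allFin m} x∈)

  ∈-Mcols⁻ : ∀ {x} → x ∈ Mcols m a b → MColumn x
  ∈-Mcols⁻ (here refl) = vertical
  ∈-Mcols⁻ (there x∈) with ∈-blocks⁻ x∈
  ... | t , x∈block with ∈-column-block⁻ x∈block
  ... | j , refl , a≤j , j≤b , coprime = slanted t a≤j j≤b coprime

  ∈-Mcols⁺ : ∀ {x} → MColumn x → x ∈ Mcols m a b
  ∈-Mcols⁺ vertical = here refl
  ∈-Mcols⁺ (slanted t a≤j j≤b coprime) =
    there (∈-concatMap⁺ column-block {xs = allFin m} (lose (∈-allFin t) (∈-colsWithFirst⁺ a≤j j≤b coprime)))

  MColumn⇒Primitive : ∀ {x} → MColumn x → Primitive x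
  MColumn⇒Primitive vertical = vertical
  MColumn⇒Primitive (slanted t _ _ coprime) = slanted (toℕ t) coprime

  Mcols-unique : Unique (Mcols m a b)
  Mcols-unique = All.tabulate vertical-first
    AllPairs.∷ Unique.concat⁺ (All.map⁺ (All.tabulate λ {t} _ → colsWithFirst-unique (suc (toℕ t)) (a t) (b t)))
                              (AllPairs.map⁺ (AllPairs.map blocks-disjoint (Unique.allFin⁺ m)))
    where
    vertical-first : ∀ {x} → x ∈ concatMap column-block (allFin m) → (+ 0 , + 1) ≢ x
    vertical-first x∈ with ∈-blocks⁻ x∈
    ... | t , x∈block with ∈-column-block⁻ x∈block
    ... | j , refl , _ = λ ()
    blocks-disjoint : ∀ {t t′} → t ≢ t′ → Disjoint (column-block t) (column-block t′)
    blocks-disjoint t≢t′ (x∈t , x∈t′) with ∈-column-block⁻ x∈t | ∈-column-block⁻ x∈t′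
    ... | _ , refl , _ | _ , x≡ , _ = t≢t′ (toℕ-injective (ℕ.suc-injective (+-injective (cong proj₁ x≡))))

Unique⇒lookup-injective : ∀ {xs : List A} → Unique xs → ∀ i j → lookup xs i ≡ lookup xs j → i ≡ j
Unique⇒lookup-injective {xs = x ∷ xs} _ Fin.zero Fin.zero _ = refl
Unique⇒lookup-injective {xs = x ∷ xs} (x∉xs AllPairs.∷ _) Fin.zero (Fin.suc j) x≡ =
  contradiction x≡ (All.lookup x∉xs (∈-lookup j))
Unique⇒lookup-injective {xs = x ∷ xs} (x∉xs AllPairs.∷ _) (Fin.suc i) Fin.zero ≡x =
  contradiction (sym ≡x) (All.lookup x∉xs (∈-lookup i))
Unique⇒lookup-injective {xs = x ∷ xs} (_ AllPairs.∷ unique) (Fin.suc i) (Fin.suc j) eq =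
  cong Fin.suc (Unique⇒lookup-injective unique i j eq)

Mmat-generic : ∀ m a b → Generic (Mmat m a b)
Mmat-generic m a b i j i≢j det≡0 = i≢j (Unique⇒lookup-injective (Mcols-unique a b) i j
  (primitive-det≡0⇒≡ (column-primitive i) (column-primitive j) det≡0))
  where
  column-primitive : ∀ i → Primitive (Mmat m a b i)
  column-primitive i = MColumn⇒Primitive a b (∈-Mcols⁻ a b (∈-lookup i))

injection⇒≤length : ∀ {xs : List A} (f : Fin n → A) → (∀ {i j} → f i ≡ f j → i ≡ j) → (∀ i → f i ∈ xs) →
  n ℕ.≤ length xs
injection⇒≤length {xs = xs} f f-injective f∈xs = injective⇒≤ {f = λ i → Any.index (f∈xs i)} λ {i} {j} index≡ →
  f-injective (trans (lookup-index (f∈xs i)) (trans (cong (lookup xs) index≡) (sym (lookup-index (f∈xs j)))))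

lookup-rank2 : ∀ {xs u v} → u ∈ xs → v ∈ xs → det u v ≢ 0ℤ → Rank2 (lookup xs)
lookup-rank2 u∈ v∈ det≢0 = Any.index u∈ , Any.index v∈ ,
  subst₂ (λ u v → det u v ≢ 0ℤ) (lookup-index u∈) (lookup-index v∈) det≢0

secondsAt : ℕ → List Col → List ℤ
secondsAt k cs = map proj₂ (filter (λ u → proj₁ u ℤ.≟ + k) cs)

∈-secondsAt⁺ : ∀ {k j cs} → (+ k , j) ∈ cs → j ∈ secondsAt k cs
∈-secondsAt⁺ {k} u∈ = ∈-map⁺ proj₂ (∈-filter⁺ (λ u → proj₁ u ℤ.≟ + k) u∈ refl)

∈-secondsAt⁻ : ∀ {k j cs} → j ∈ secondsAt k cs → (+ k , j) ∈ cs
∈-secondsAt⁻ {k} {cs = cs} j∈ with ∈-map⁻ proj₂ j∈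
... | (_ , j) , u∈ , refl with ∈-filter⁻ (λ u → proj₁ u ℤ.≟ + k) {xs = cs} u∈
... | u∈cs , refl = u∈cs

-- (+1 , +0) encodes the empty interval.
extent : List ℤ → ℤ × ℤ
extent [] = (+ 1 , + 0)
extent (x ∷ xs) = (min x xs , max x xs)

extent-∋ : ∀ {xs x} → x ∈ xs → proj₁ (extent xs) ≤ x × x ≤ proj₂ (extent xs)
extent-∋ {y ∷ ys} (here refl) = min≤⊤ y ys , ⊥≤max y ys
extent-∋ {y ∷ ys} (there x∈) = All.lookup (min≤xs y ys) x∈ , All.lookup (xs≤max y ys) x∈

extent-∈ : ∀ xs → proj₁ (extent xs) ≤ proj₂ (extent xs) → proj₁ (extent xs) ∈ xs × proj₂ (extent xs) ∈ xs
extent-∈ [] (+≤+ ())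
extent-∈ (x ∷ xs) _ = selected (argmin-sel (λ y → y) x xs) , selected (argmax-sel (λ y → y) x xs)
  where
  selected : ∀ {y} → y ≡ x ⊎ y ∈ xs → y ∈ x ∷ xs
  selected (inj₁ refl) = here refl
  selected (inj₂ y∈) = there y∈

hullLower hullUpper : (m : ℕ) → List Col → Fin m → ℤ
hullLower m cs t = proj₁ (extent (secondsAt (suc (toℕ t)) cs))
hullUpper m cs t = proj₂ (extent (secondsAt (suc (toℕ t)) cs))

module _ (m : ℕ) {cs : List Col} where

  hull-∋ : ∀ {u} → u ∈ cs → Primitive u → ∣ proj₁ u ∣ ℕ.≤ m → u ∈ Mcols m (hullLower m cs) (hullUpper m cs)
  hull-∋ _ vertical _ = here refl
  hull-∋ u∈ (slanted k coprime) k<m with Fin.fromℕ< k<m | toℕ-fromℕ< k<m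
  ... | t | refl = ∈-Mcols⁺ (hullLower m cs) (hullUpper m cs) (slanted t (proj₁ bounds) (proj₂ bounds) coprime)
    where
    bounds : hullLower m cs t ≤ _ × _ ≤ hullUpper m cs t
    bounds = extent-∋ (∈-secondsAt⁺ u∈)

-- For k, k′ ≥ 0, det (k , j) (k′ , j′) is increasing in j′ and decreasing in j, so on a box it is
-- bounded by its values at two opposite corners.
∣det∣-corner-bound : ∀ {D} k k′ {lo j hi lo′ j′ hi′} → lo ≤ j → j ≤ hi → lo′ ≤ j′ → j′ ≤ hi′ →
  ∣ det (+ k , lo) (+ k′ , hi′) ∣ ℕ.≤ D → ∣ det (+ k , hi) (+ k′ , lo′) ∣ ℕ.≤ D →
  ∣ det (+ k , j) (+ k′ , j′) ∣ ℕ.≤ D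
∣det∣-corner-bound k k′ {lo} {j} {hi} {lo′} {j′} {hi′} lo≤j j≤hi lo′≤j′ j′≤hi′ ∣upper∣≤D ∣lower∣≤D =
  -n≤i≤n⇒∣i∣≤n (≤-trans (∣i∣≤n⇒-n≤i {lower} ∣lower∣≤D) lower≤middle)
               (≤-trans middle≤upper (∣i∣≤n⇒i≤n ∣upper∣≤D))
  where
  lower middle upper : ℤ
  lower = det (+ k , hi) (+ k′ , lo′)
  middle = det (+ k , j) (+ k′ , j′)
  upper = det (+ k , lo) (+ k′ , hi′)
  identity : ∀ k k′ j j′ i i′ → (k * i′ - k′ * i) - (k * j′ - k′ * j) ≡ k * (i′ - j′) + k′ * (j - i)
  identity = solve-∀
  lower≤middle : lower ≤ middle
  lower≤middle = ≤-by-difference (identity (+ k) (+ k′) hi lo′ j j′)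
    (+-mono-≤ (0≤c*[j-i] (0≤+ k) lo′≤j′) (0≤c*[j-i] (0≤+ k′) j≤hi))
  middle≤upper : middle ≤ upper
  middle≤upper = ≤-by-difference (identity (+ k) (+ k′) j j′ lo hi′)
    (+-mono-≤ (0≤c*[j-i] (0≤+ k) j′≤hi′) (0≤c*[j-i] (0≤+ k′) lo≤j))

∣det[vertical,u]∣ : ∀ u → ∣ det (+ 0 , + 1) u ∣ ≡ ∣ proj₁ u ∣
∣det[vertical,u]∣ (x , y) = trans (cong ∣_∣ (identity x y)) (∣-i∣≡∣i∣ x)
  where
  identity : ∀ x y → + 0 * y - x * + 1 ≡ - x
  identity = solve-∀

∣det[u,vertical]∣ : ∀ u → ∣ det u (+ 0 , + 1) ∣ ≡ ∣ proj₁ u ∣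
∣det[u,vertical]∣ (x , y) = cong ∣_∣ (identity x y)
  where
  identity : ∀ x y → x * + 1 - + 0 * y ≡ x
  identity = solve-∀

module _ {Δ m : ℕ} (cs : List Col) (m≤Δ : m ℕ.≤ Δ)
         (cs-bounded : ∀ {u v} → u ∈ cs → v ∈ cs → ∣ det u v ∣ ℕ.≤ Δ) where

  private
    a b : Fin m → ℤ
    a = hullLower m cs
    b = hullUpper m cs

  hull-corners∈ : ∀ t {j} → a t ≤ j → j ≤ b t → (+ suc (toℕ t) , a t) ∈ cs × (+ suc (toℕ t) , b t) ∈ cs
  hull-corners∈ t a≤j j≤b with extent-∈ (secondsAt (suc (toℕ t)) cs) (≤-trans a≤j j≤b)
  ... | lo∈ , hi∈ = ∈-secondsAt⁻ lo∈ , ∈-secondsAt⁻ hi∈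

  MColumn-minor-bounded : ∀ {u v} → MColumn a b u → MColumn a b v → ∣ det u v ∣ ℕ.≤ Δ
  MColumn-minor-bounded vertical vertical = z≤n
  MColumn-minor-bounded vertical (slanted t {j} _ _ _) =
    subst (ℕ._≤ Δ) (sym (∣det[vertical,u]∣ (+ suc (toℕ t) , j))) (ℕ.≤-trans (toℕ<n t) m≤Δ)
  MColumn-minor-bounded (slanted t {j} _ _ _) vertical =
    subst (ℕ._≤ Δ) (sym (∣det[u,vertical]∣ (+ suc (toℕ t) , j))) (ℕ.≤-trans (toℕ<n t) m≤Δ)
  MColumn-minor-bounded (slanted t a≤j j≤b _) (slanted t′ a≤j′ j′≤b′ _)
    with hull-corners∈ t a≤j j≤b | hull-corners∈ t′ a≤j′ j′≤b′
  ... | lo∈ , hi∈ | lo′∈ , hi′∈ =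
    ∣det∣-corner-bound (suc (toℕ t)) (suc (toℕ t′)) a≤j j≤b a≤j′ j′≤b′
      (cs-bounded lo∈ hi′∈) (cs-bounded hi∈ lo′∈)

  hull-minorsBounded : MinorsBounded Δ (Mmat m a b)
  hull-minorsBounded i j = MColumn-minor-bounded (∈-Mcols⁻ a b (∈-lookup i)) (∈-Mcols⁻ a b (∈-lookup j))

primitive-columns⇒type-m : ∀ {Δ} m (P : Fin n → Col) → (∀ i → Primitive (P i)) → FirstRowBounded m P → m ℕ.≤ Δ →
  Rank2 P → Generic P → MinorsBounded Δ P →
  ∃₂ λ a b → Generic (Mmat m a b) × IsSubmodular Δ (Mmat m a b) × n ℕ.≤ length (Mcols m a b)
primitive-columns⇒type-m {n} {Δ} m P P-primitive rows m≤Δ (i₀ , j₀ , det≢0) generic bounded =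
  a , b , Mmat-generic m a b , (lookup-rank2 (P∈M i₀) (P∈M j₀) det≢0 , hull-minorsBounded cs m≤Δ cs-bounded) ,
  injection⇒≤length P (generic⇒injective generic) P∈M
  where
  cs : List Col
  cs = tabulate P
  a b : Fin m → ℤ
  a = hullLower m cs
  b = hullUpper m cs
  P∈M : ∀ i → P i ∈ Mcols m a b
  P∈M i = hull-∋ m (∈-tabulate⁺ i) (P-primitive i) (rows i)
  cs-bounded : ∀ {u v} → u ∈ cs → v ∈ cs → ∣ det u v ∣ ℕ.≤ Δ
  cs-bounded u∈ v∈ with ∈-tabulate⁻ u∈ | ∈-tabulate⁻ v∈
  ... | i , refl | j , refl = bounded i j

-- The constant √(π/2)

n/1≡mkℚ : ∀ n → + n ℚ./ 1 ≡ mkℚ (+ n) 0 (Coprime.sym (1-coprimeTo n))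
n/1≡mkℚ n = ℚ.normalize-coprime (Coprime.sym (1-coprimeTo n))

3/2≤eulerPartial3 : + 3 ℚ./ 2 ℚ.≤ eulerPartial 3
3/2≤eulerPartial3 = toWitness {a? = + 3 ℚ./ 2 ℚ.≤? eulerPartial 3} tt

m²≤Δ*3/2 : ∀ m Δ → 2 ℕ.* (m ℕ.* m) ℕ.≤ 3 ℕ.* Δ → + (m ℕ.* m) ℚ./ 1 ℚ.≤ (+ Δ ℚ./ 1) ℚ.* (+ 3 ℚ./ 2)
m²≤Δ*3/2 m Δ 2m²≤3Δ = ℚ.toℚᵘ-cancel-≤ (begin
  toℚᵘ (+ (m ℕ.* m) ℚ./ 1)                ≡⟨ cong toℚᵘ (n/1≡mkℚ (m ℕ.* m)) ⟩
  mkℚᵘ (+ (m ℕ.* m)) 0                    ≤⟨ *≤* (subst₂ ℤ._≤_ lhs rhs (+≤+ 2m²≤3Δ)) ⟩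
  mkℚᵘ (+ Δ) 0 ℚᵘ.* toℚᵘ (+ 3 ℚ./ 2)      ≡⟨ cong (λ p → toℚᵘ p ℚᵘ.* toℚᵘ (+ 3 ℚ./ 2)) (n/1≡mkℚ Δ) ⟨
  toℚᵘ (+ Δ ℚ./ 1) ℚᵘ.* toℚᵘ (+ 3 ℚ./ 2)  ≃⟨ ℚ.toℚᵘ-homo-* (+ Δ ℚ./ 1) (+ 3 ℚ./ 2) ⟨
  toℚᵘ ((+ Δ ℚ./ 1) ℚ.* (+ 3 ℚ./ 2))      ∎)
  where
  open ℚᵘ.≤-Reasoning
  lhs : + (2 ℕ.* (m ℕ.* m)) ≡ + (m ℕ.* m) ℤ.* + 2
  lhs = trans (cong +_ (ℕ.*-comm 2 (m ℕ.* m))) (pos-* (m ℕ.* m) 2)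
  rhs : + (3 ℕ.* Δ) ≡ (+ Δ ℤ.* + 3) ℤ.* + 1
  rhs = trans (cong +_ (ℕ.*-comm 3 Δ)) (trans (pos-* Δ 3) (sym (*-identityʳ _)))

2m²≤3Δ⇒LeSqrtHalfPiDelta : ∀ m Δ → 2 ℕ.* (m ℕ.* m) ℕ.≤ 3 ℕ.* Δ → LeSqrtHalfPiDelta m Δ
2m²≤3Δ⇒LeSqrtHalfPiDelta m Δ 2m²≤3Δ =
  3 , ℚ.≤-trans (m²≤Δ*3/2 m Δ 2m²≤3Δ) (ℚ.*-monoˡ-≤-nonNeg (+ Δ ℚ./ 1) 3/2≤eulerPartial3)
  where
  instance
    Δ/1-nonNeg : ℚ.NonNegative (+ Δ ℚ./ 1)
    Δ/1-nonNeg = ℚ.normalize-nonNeg Δ 1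

positive-bound : ∀ {Δ} L → 1 ℕ.≤ Δ → 2 ℕ.* (L ℕ.* L) ℕ.≤ 3 ℕ.* Δ →
  ∃ λ m → 1 ℕ.≤ m × L ℕ.≤ m × 2 ℕ.* (m ℕ.* m) ℕ.≤ 3 ℕ.* Δ
positive-bound {Δ} zero 1≤Δ _ = 1 , ℕ.≤-refl , z≤n , ℕ.≤-trans (ℕ.*-monoʳ-≤ 2 1≤Δ) (ℕ.*-monoˡ-≤ Δ (ℕ.n≤1+n 2))
positive-bound (suc l) _ 2L²≤3Δ = suc l , s≤s z≤n , ℕ.≤-refl , 2L²≤3Δ

2m²≤3Δ⇒m≤Δ : ∀ m {Δ} → 2 ℕ.* (m ℕ.* m) ℕ.≤ 3 ℕ.* Δ → m ℕ.≤ Δ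
2m²≤3Δ⇒m≤Δ zero _ = z≤n
2m²≤3Δ⇒m≤Δ (suc zero) {zero} ()
2m²≤3Δ⇒m≤Δ (suc zero) {suc Δ} _ = s≤s z≤n
2m²≤3Δ⇒m≤Δ m@(suc (suc k)) {Δ} 2m²≤3Δ = ℕ.*-cancelˡ-≤ 3 (begin
  3 ℕ.* m          ≤⟨ ℕ.*-monoˡ-≤ m (ℕ.n≤1+n 3) ⟩
  4 ℕ.* m          ≡⟨ ℕ.*-assoc 2 2 m ⟩
  2 ℕ.* (2 ℕ.* m)  ≤⟨ ℕ.*-monoʳ-≤ 2 (ℕ.*-monoˡ-≤ m {2} {m} (s≤s (s≤s z≤n))) ⟩
  2 ℕ.* (m ℕ.* m)  ≤⟨ 2m²≤3Δ ⟩
  3 ℕ.* Δ          ∎)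
  where
  open ℕ.≤-Reasoning

-- Distinctness of the columns follows from genericity, and only the upper bound Δ(A) ≤ Δ is used.
proposition3p4 : (Δ : ℕ) → 2 ℕ.≤ Δ → (n : ℕ) → (A : Fin n → Col)
    → DistinctCols A → IsModular Δ A → Generic A
    → Σ ℕ λ m → 1 ℕ.≤ m × LeSqrtHalfPiDelta m Δ
    × Σ (Fin m → ℤ) λ a → Σ (Fin m → ℤ) λ b →
    Generic (Mmat m a b) × IsSubmodular Δ (Mmat m a b) × n ℕ.≤ length (Mcols m a b)
proposition3p4 Δ 2≤Δ n A _ (rank , bounded , _) generic =
  let P , L , P-primitive , P-rows , P-rank , P-generic , P-bounded , 2L²≤3Δ =
        primitive-reduction A rank generic bounded
      m , 1≤m , L≤m , 2m²≤3Δ = positive-bound L (ℕ.≤-trans (s≤s z≤n) 2≤Δ) 2L²≤3Δ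
  in m , 1≤m , 2m²≤3Δ⇒LeSqrtHalfPiDelta m Δ 2m²≤3Δ ,
     primitive-columns⇒type-m m P P-primitive (λ i → ℕ.≤-trans (P-rows i) L≤m) (2m²≤3Δ⇒m≤Δ m 2m²≤3Δ)
       P-rank P-generic P-bounded
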